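{- Let $G$ be a cubic graph containing two vertex-disjoint subgraphs $D_1$ and $D_2$, each isomorphic to the diamond (the graph $K_4$ minus one edge), together with an edge joining a vertex of $D_1$ to a vertex of $D_2$. Then $\chi'_{\mathrm{irr}}(G) \ge 3$, i.e., $G$ admits no locally irregular edge-coloring using at most $2$ colors.
   Context: A graph is locally irregular if no two adjacent vertices have the same degree. A locally irregular edge-coloring of a graph is an (not necessarily proper) edge-coloring such that the edges of each color induce a locally irregular graph; equivalently, for every edge $xy$ of color $i$, the numbers of edges of color $i$ at $x$ and at $y$ differ. $\chi'_{\mathrm{irr}}(G)$ denotes the minimum number of colors in such a coloring of $G$. -}

module Defs where

open import Data.Nat using (ℕ; zero; suc)
open import Data.Bool using (Bool; true; false; if_then_else_)
open import Data.Fin using (Fin; zero; suc)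
open import Data.Fin.Properties using (_≟_)
open import Data.Product using (Σ; _×_; _,_; ∃; ∃-syntax)
open import Relation.Nullary using (¬_; does)
open import Relation.Binary.PropositionalEquality using (_≡_; _≢_)
open import Function.Definitions using (Injective)

count : ∀ {n} → (Fin n → Bool) → ℕ
count {zero}  p = zero
count {suc n} p = (if p zero then suc else (λ k → k)) (count (λ i → p (suc i)))

record Graph (n : ℕ) : Set where
  field
    adj     : Fin n → Fin n → Bool
    sym     : ∀ x y → adj x y ≡ adj y x
    irrefl  : ∀ x → adj x x ≡ false
open Graph public

Adj : ∀ {n} → Graph n → Fin n → Fin n → Set
Adj G x y = adj G x y ≡ true

degree : ∀ {n} → Graph n → Fin n → ℕ
degree G x = count (adj G x)

Cubic : ∀ {n} → Graph n → Set
Cubic G = ∀ x → degree G x ≡ 3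

-- Diamond (K4 minus an edge) on vertices 0,1,2,3, missing edge {2,3}:
-- edges 01, 02, 03, 12, 13.
diamondEdge : Fin 4 → Fin 4 → Bool
diamondEdge a b = Data.Bool.not (does (a ≟ b)) Data.Bool.∧ notMissing a b
  where
    notMissing : Fin 4 → Fin 4 → Bool
    notMissing (suc (suc zero)) (suc (suc (suc zero))) = false
    notMissing (suc (suc (suc zero))) (suc (suc zero)) = false
    notMissing _ _ = true

-- A (not necessarily induced) subgraph of G isomorphic to the diamond:
-- an injective vertex map sending every diamond edge to an edge of G.
DiamondIn : ∀ {n} → Graph n → (Fin 4 → Fin n) → Set
DiamondIn G f = Injective _≡_ _≡_ f × (∀ a b → diamondEdge a b ≡ true → Adj G (f a) (f b))

-- Edge 2-colouring (colour of edge xy given by c x y; symmetric on edges).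
-- Number of edges of colour i at x.
colDeg : ∀ {n} → Graph n → (Fin n → Fin n → Fin 2) → Fin 2 → Fin n → ℕ
colDeg G c i x = count (λ y → adj G x y Data.Bool.∧ does (c x y ≟ i))

LocallyIrregular2Coloring : ∀ {n} → Graph n → (Fin n → Fin n → Fin 2) → Set
LocallyIrregular2Coloring G c =
  (∀ x y → Adj G x y → c x y ≡ c y x) ×
  (∀ x y → Adj G x y → colDeg G c (c x y) x ≢ colDeg G c (c x y) y)

-- In a cubic graph both centres of a diamond have all three neighbours inside it, so an edge
-- leaving a diamond starts at one of its two tips x.  In a locally irregular 2-edge-colouring
-- the two diamond edges at x get different colours (a check of the 2⁷ colourings of the diamond
-- and its two pendant edges), so whatever colour the pendant edge at x has, it occurs exactly
-- twice at x.  The edge joining D₁ and D₂ is pendant at both ends, so its colour would occur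
-- twice at each end, contradicting local irregularity.
module Submission where

open import Defs hiding (sym)
open import Data.Nat using (ℕ; zero; suc; _+_; _≤_; _<_; z≤n; s≤s; s≤s⁻¹)
import Data.Nat as ℕ
open import Data.Nat.Properties using (+-suc; m≤n⇒m≤1+n; 1+n≰n; ≤-trans; ≤-reflexive)
open import Data.Nat.ListAction using (sum)
open import Data.Bool using (Bool; true; false; _∧_; _∨_; if_then_else_)
import Data.Bool.Properties as Bool
open import Data.Fin using (Fin; zero; suc)
open import Data.Fin.Patterns using (0F; 1F; 2F; 3F)
open import Data.Fin.Properties using (_≟_; all?)
open import Data.Fin.Permutation using (Permutation; _⟨$⟩ʳ_; transpose)
open import Data.List using (List; []; _∷_; length; map)
open import Data.Bool.ListAction using (any)
open import Data.List.Properties using (map-∘)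
open import Data.List.Relation.Unary.All using (All; []; _∷_)
open import Data.List.Relation.Unary.Unique.Propositional using (Unique; []; _∷_)
open import Data.Product using (_×_; _,_; proj₁; proj₂; ∃-syntax)
import Data.Product as Product
open import Data.Empty using (⊥-elim)
open import Function using (_∘_; id)
open import Function.Bundles using (Injection)
open import Function.Properties.Inverse using (↔⇒↣)
open import Relation.Nullary using (¬_; Dec; does; yes; no; ¬?)
open import Relation.Nullary.Decidable using (from-yes; _→-dec_; dec-false; map′)
open import Relation.Nullary.Negation using (contradiction)
open import Relation.Binary.PropositionalEquality
  using (_≡_; _≢_; _≗_; refl; sym; trans; cong; cong₂; subst; ≢-sym; module ≡-Reasoning)

boolToℕ : Bool → ℕ
boolToℕ false = 0
boolToℕ true  = 1

_⊆_ : ∀ {n} → (Fin n → Bool) → (Fin n → Bool) → Set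
p ⊆ q = ∀ x → p x ≡ true → q x ≡ true

module _ where
  private variable
    n : ℕ
    p q : Fin n → Bool

  count-false : count {n} (λ _ → false) ≡ 0
  count-false {zero}  = refl
  count-false {suc n} = count-false {n}

  count-cong : p ≗ q → count p ≡ count q
  count-cong {zero}          _   = refl
  count-cong {suc n} {p} {q} p≗q rewrite p≗q zero =
    cong (if q zero then suc else id) (count-cong (p≗q ∘ suc))

  count-∨ : (∀ x → p x ≡ true → q x ≡ false) → count (λ x → p x ∨ q x) ≡ count p + count q
  count-∨ {zero}          _    = refl
  count-∨ {suc n} {p} {q} disj with p zero in p₀ | q zero in q₀
  ... | true  | true  = contradiction (trans (sym (disj zero p₀)) q₀) λ ()
  ... | true  | false = cong suc (count-∨ (disj ∘ suc))
  ... | false | true  = trans (cong suc (count-∨ (disj ∘ suc))) (sym (+-suc _ _))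
  ... | false | false = count-∨ (disj ∘ suc)

  count-≟-∧ : (a : Fin n) (q : Fin n → Bool) → count (λ x → does (x ≟ a) ∧ q x) ≡ boolToℕ (q a)
  count-≟-∧ {suc n} 0F q with q 0F
  ... | true  = cong suc (count-false {n})
  ... | false = count-false {n}
  count-≟-∧ (suc a) q = count-≟-∧ a (q ∘ suc)

  count-mono : p ⊆ q → count p ≤ count q
  count-mono {zero}          _   = z≤n
  count-mono {suc n} {p} {q} p⊆q with p zero in p₀ | q zero in q₀
  ... | true  | true  = s≤s (count-mono (p⊆q ∘ suc))
  ... | true  | false = contradiction (trans (sym (p⊆q zero p₀)) q₀) λ ()
  ... | false | true  = m≤n⇒m≤1+n (count-mono (p⊆q ∘ suc))
  ... | false | false = count-mono (p⊆q ∘ suc)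

  ⊆∧count≤⇒≗ : p ⊆ q → count q ≤ count p → p ≗ q
  ⊆∧count≤⇒≗ {suc n} {p} {q} p⊆q q≤p x with p zero in p₀ | q zero in q₀ | x
  ... | true  | true  | 0F    = trans p₀ (sym q₀)
  ... | true  | true  | suc y = ⊆∧count≤⇒≗ (p⊆q ∘ suc) (s≤s⁻¹ q≤p) y
  ... | false | false | 0F    = trans p₀ (sym q₀)
  ... | false | false | suc y = ⊆∧count≤⇒≗ (p⊆q ∘ suc) q≤p y
  ... | true  | false | _     = contradiction (trans (sym (p⊆q zero p₀)) q₀) λ ()
  ... | false | true  | _     = contradiction (≤-trans q≤p (count-mono (p⊆q ∘ suc))) 1+n≰n

  ⊆∧count<⇒∃ : p ⊆ q → count p < count q → ∃[ x ] q x ≡ true × p x ≡ false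
  ⊆∧count<⇒∃ {zero}          _   ()
  ⊆∧count<⇒∃ {suc n} {p} {q} p⊆q p<q with p zero in p₀ | q zero in q₀
  ... | true  | true  = Product.map suc id (⊆∧count<⇒∃ (p⊆q ∘ suc) (s≤s⁻¹ p<q))
  ... | true  | false = contradiction (trans (sym (p⊆q zero p₀)) q₀) λ ()
  ... | false | true  = 0F , q₀ , p₀
  ... | false | false = Product.map suc id (⊆∧count<⇒∃ (p⊆q ∘ suc) p<q)

memberᵇ : ∀ {n} → List (Fin n) → Fin n → Bool
memberᵇ xs x = any (λ a → does (x ≟ a)) xs

module _ {n : ℕ} where
  private variable
    x : Fin n
    xs : List (Fin n)

  All⇒memberᵇ⊆ : {p : Fin n → Bool} → All (λ a → p a ≡ true) xs → memberᵇ xs ⊆ p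
  All⇒memberᵇ⊆ {xs = a ∷ _} (pa ∷ ps) x h with x ≟ a
  ... | yes refl = pa
  ... | no  _    = All⇒memberᵇ⊆ ps x h

  All≢⇒memberᵇ≡false : All (x ≢_) xs → memberᵇ xs x ≡ false
  All≢⇒memberᵇ≡false                  []           = refl
  All≢⇒memberᵇ≡false {x} {xs = a ∷ _} (x≢a ∷ x∉) rewrite dec-false (x ≟ a) x≢a =
    All≢⇒memberᵇ≡false x∉

  memberᵇ≡false⇒All≢ : memberᵇ xs x ≡ false → All (x ≢_) xs
  memberᵇ≡false⇒All≢ {[]}             _ = []
  memberᵇ≡false⇒All≢ {a ∷ _} {x} h with x ≟ a
  memberᵇ≡false⇒All≢ {a ∷ _} ()       | yes _
  memberᵇ≡false⇒All≢ {a ∷ _}     h    | no x≢a = x≢a ∷ memberᵇ≡false⇒All≢ h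

  count-memberᵇ-∧ : Unique xs → (q : Fin n → Bool) →
                    count (λ x → memberᵇ xs x ∧ q x) ≡ sum (map (boolToℕ ∘ q) xs)
  count-memberᵇ-∧                 []          q = count-false {n}
  count-memberᵇ-∧ {xs = a ∷ as} (a∉ ∷ uniq) q = begin
    count (λ x → (does (x ≟ a) ∨ memberᵇ as x) ∧ q x)
      ≡⟨ count-cong (λ x → Bool.∧-distribʳ-∨ (q x) (does (x ≟ a)) (memberᵇ as x)) ⟩
    count (λ x → (does (x ≟ a) ∧ q x) ∨ (memberᵇ as x ∧ q x))
      ≡⟨ count-∨ disjoint ⟩
    count (λ x → does (x ≟ a) ∧ q x) + count (λ x → memberᵇ as x ∧ q x)
      ≡⟨ cong₂ _+_ (count-≟-∧ a q) (count-memberᵇ-∧ uniq q) ⟩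
    boolToℕ (q a) + sum (map (boolToℕ ∘ q) as) ∎
    where
      open ≡-Reasoning
      disjoint : ∀ x → does (x ≟ a) ∧ q x ≡ true → memberᵇ as x ∧ q x ≡ false
      disjoint x h  with x ≟ a
      disjoint x h  | yes refl rewrite All≢⇒memberᵇ≡false a∉ = refl
      disjoint x () | no _

  count-memberᵇ : Unique xs → count (memberᵇ xs) ≡ length xs
  count-memberᵇ {xs} uniq =
    trans (count-cong (λ x → sym (Bool.∧-identityʳ (memberᵇ xs x))))
          (trans (count-memberᵇ-∧ uniq (λ _ → true)) (sum-ones xs))
    where
      sum-ones : ∀ ys → sum (map (λ _ → 1) ys) ≡ length ys
      sum-ones []       = refl
      sum-ones (_ ∷ ys) = cong suc (sum-ones ys)

occurrences : Fin 2 → List (Fin 2) → ℕ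
occurrences k es = sum (map (λ e → boolToℕ (does (e ≟ k))) es)

occurrences-≢-pair : ∀ {a b} → a ≢ b → ∀ k → occurrences k (a ∷ b ∷ k ∷ []) ≡ 2
occurrences-≢-pair {0F} {0F} a≢b _  = contradiction refl a≢b
occurrences-≢-pair {0F} {1F} _   0F = refl
occurrences-≢-pair {0F} {1F} _   1F = refl
occurrences-≢-pair {1F} {0F} _   0F = refl
occurrences-≢-pair {1F} {0F} _   1F = refl
occurrences-≢-pair {1F} {1F} a≢b _  = contradiction refl a≢b

record Irregular (k : Fin 2) (es fs : List (Fin 2)) : Set where
  constructor irregular
  field occurrences-differ : occurrences k es ≢ occurrences k fs

irregular? : ∀ k es fs → Dec (Irregular k es fs)
irregular? k es fs =
  map′ irregular Irregular.occurrences-differ (¬? (occurrences k es ℕ.≟ occurrences k fs))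

-- Colours are named after the edges of a diamond with centres u, v, tips x, y and pendant
-- edges xz, yw.  If ux and vx had the same colour β, irregularity of uv would force uy ≠ vy,
-- irregularity of ux and vx would then force uv ≠ β = xz, and after that uy and vy cannot
-- both be irregular.
tip-colours-differ : ∀ uv ux uy vx vy xz yw →
  let atu = uv ∷ ux ∷ uy ∷ []
      atv = uv ∷ vx ∷ vy ∷ []
      atx = ux ∷ vx ∷ xz ∷ []
      aty = uy ∷ vy ∷ yw ∷ []
  in Irregular uv atu atv → Irregular ux atu atx → Irregular uy atu aty →
     Irregular vx atv atx → Irregular vy atv aty → ux ≢ vx
tip-colours-differ = from-yes
  (all? λ uv → all? λ ux → all? λ uy → all? λ vx → all? λ vy → all? λ xz → all? λ yw →
    let atu = uv ∷ ux ∷ uy ∷ []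
        atv = uv ∷ vx ∷ vy ∷ []
        atx = ux ∷ vx ∷ xz ∷ []
        aty = uy ∷ vy ∷ yw ∷ []
    in irregular? uv atu atv →-dec irregular? ux atu atx →-dec irregular? uy atu aty →-dec
       irregular? vx atv atx →-dec irregular? vy atv aty →-dec ¬? (ux ≟ vx))

Adj-sym : ∀ {n} (G : Graph n) {x y} → Adj G x y → Adj G y x
Adj-sym G {x} {y} xy = trans (Graph.sym G y x) xy

module _ {n} (G : Graph n) {v : Fin n} {ns : List (Fin n)}
         (uniq : Unique ns) (adjs : All (Adj G v) ns) where

  adj≗memberᵇ : degree G v ≡ length ns → adj G v ≗ memberᵇ ns
  adj≗memberᵇ deg x =
    sym (⊆∧count≤⇒≗ (All⇒memberᵇ⊆ adjs) (≤-reflexive (trans deg (sym (count-memberᵇ uniq)))) x)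

  ¬Adj-outside : degree G v ≡ length ns → ∀ {x} → All (x ≢_) ns → ¬ Adj G v x
  ¬Adj-outside deg {x} x∉ vx =
    contradiction (trans (sym vx) (trans (adj≗memberᵇ deg x) (All≢⇒memberᵇ≡false x∉))) λ ()

  ∃-neighbour-outside : length ns < degree G v → ∃[ w ] Adj G v w × All (w ≢_) ns
  ∃-neighbour-outside ns<deg =
    Product.map id (Product.map id memberᵇ≡false⇒All≢)
      (⊆∧count<⇒∃ (All⇒memberᵇ⊆ adjs) (subst (_< degree G v) (sym (count-memberᵇ uniq)) ns<deg))

  colDeg≡occurrences : (c : Fin n → Fin n → Fin 2) → degree G v ≡ length ns →
                       ∀ k → colDeg G c k v ≡ occurrences k (map (c v) ns)
  colDeg≡occurrences c deg k = begin
    colDeg G c k v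
      ≡⟨ count-cong (λ x → cong (_∧ does (c v x ≟ k)) (adj≗memberᵇ deg x)) ⟩
    count (λ x → memberᵇ ns x ∧ does (c v x ≟ k))
      ≡⟨ count-memberᵇ-∧ uniq (λ x → does (c v x ≟ k)) ⟩
    sum (map (λ x → boolToℕ (does (c v x ≟ k))) ns)
      ≡⟨ cong sum (map-∘ ns) ⟩
    occurrences k (map (c v) ns) ∎
    where open ≡-Reasoning

unique₃ : ∀ {n} {a b d : Fin n} → a ≢ b → a ≢ d → b ≢ d → Unique (a ∷ b ∷ d ∷ [])
unique₃ ab ad bd = (ab ∷ ad ∷ []) ∷ (bd ∷ []) ∷ [] ∷ []

DiamondAutomorphism : Permutation 4 4 → Set
DiamondAutomorphism σ = ∀ a b → diamondEdge a b ≡ true → diamondEdge (σ ⟨$⟩ʳ a) (σ ⟨$⟩ʳ b) ≡ true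

diamondAutomorphism? : ∀ σ → Dec (DiamondAutomorphism σ)
diamondAutomorphism? σ = all? λ a → all? λ b →
  (diamondEdge a b Bool.≟ true) →-dec (diamondEdge (σ ⟨$⟩ʳ a) (σ ⟨$⟩ʳ b) Bool.≟ true)

DiamondIn-∘ : ∀ {n} (G : Graph n) {f} σ → DiamondAutomorphism σ → DiamondIn G f →
              DiamondIn G (f ∘ (σ ⟨$⟩ʳ_))
DiamondIn-∘ _ σ aut (inj , edge) =
  Injection.injective (↔⇒↣ σ) ∘ inj , λ a b ab → edge _ _ (aut a b ab)

DiamondIn-distinct : ∀ {n} (G : Graph n) {f} → DiamondIn G f → ∀ i j → i ≢ j → f i ≢ f j
DiamondIn-distinct _ (inj , _) _ _ i≢j = i≢j ∘ inj

swap-centres : DiamondAutomorphism (transpose 0F 1F)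
swap-centres = from-yes (diamondAutomorphism? (transpose 0F 1F))

swap-tips : DiamondAutomorphism (transpose 2F 3F)
swap-tips = from-yes (diamondAutomorphism? (transpose 2F 3F))

module _ {n} (G : Graph n) {c : Fin n → Fin n → Fin 2} (li : LocallyIrregular2Coloring G c) where

  colour-sym : ∀ {a b} → Adj G a b → c a b ≡ c b a
  colour-sym {a} {b} = proj₁ li a b

  edge-irregular : ∀ {a b es fs} → Adj G a b →
                   (∀ k → colDeg G c k a ≡ occurrences k es) →
                   (∀ k → colDeg G c k b ≡ occurrences k fs) →
                   Irregular (c a b) es fs
  edge-irregular {a} {b} ab at-a at-b =
    irregular λ e → proj₂ li a b ab (trans (at-a _) (trans e (sym (at-b _))))

module _ {n} (G : Graph n) (cubic : Cubic G) where

  colDeg-at : ∀ c {v a b d} → a ≢ b → a ≢ d → b ≢ d → Adj G v a → Adj G v b → Adj G v d →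
              ∀ k → colDeg G c k v ≡ occurrences k (c v a ∷ c v b ∷ c v d ∷ [])
  colDeg-at c ab ad bd va vb vd =
    colDeg≡occurrences G (unique₃ ab ad bd) (va ∷ vb ∷ vd ∷ []) c (cubic _)

  diamond-centre-saturated : ∀ {f z} → DiamondIn G f → (∀ i → f i ≢ z) → ¬ Adj G (f 0F) z
  diamond-centre-saturated {f} d@(_ , edge) z∉ =
    ¬Adj-outside G (unique₃ (distinct 1F 2F λ ()) (distinct 1F 3F λ ()) (distinct 2F 3F λ ()))
      (edge 0F 1F refl ∷ edge 0F 2F refl ∷ edge 0F 3F refl ∷ [])
      (cubic _) (≢-sym (z∉ 1F) ∷ ≢-sym (z∉ 2F) ∷ ≢-sym (z∉ 3F) ∷ [])
    where
      distinct : ∀ i j → i ≢ j → f i ≢ f j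
      distinct = DiamondIn-distinct G d

  module _ {c : Fin n → Fin n → Fin 2} (li : LocallyIrregular2Coloring G c) where

    pendant-colDeg-at-tip : ∀ {f z w} → DiamondIn G f →
                            Adj G (f 2F) z → f 0F ≢ z → f 1F ≢ z →
                            Adj G (f 3F) w → f 0F ≢ w → f 1F ≢ w →
                            colDeg G c (c (f 2F) z) (f 2F) ≡ 2
    pendant-colDeg-at-tip {f} {z} {w} d@(_ , edge) xz uz vz yw uw vw =
      trans (at-x _) (occurrences-≢-pair tip-colours (c x z))
      where
        u v x y : Fin n
        u = f 0F
        v = f 1F
        x = f 2F
        y = f 3F
        distinct : ∀ i j → i ≢ j → f i ≢ f j
        distinct = DiamondIn-distinct G d
        at-u : ∀ k → colDeg G c k u ≡ occurrences k (c u v ∷ c u x ∷ c u y ∷ [])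
        at-u = colDeg-at c (distinct 1F 2F λ ()) (distinct 1F 3F λ ()) (distinct 2F 3F λ ())
                           (edge 0F 1F refl) (edge 0F 2F refl) (edge 0F 3F refl)
        at-v : ∀ k → colDeg G c k v ≡ occurrences k (c u v ∷ c v x ∷ c v y ∷ [])
        at-v k =
          trans (colDeg-at c (distinct 0F 2F λ ()) (distinct 0F 3F λ ()) (distinct 2F 3F λ ())
                             (edge 1F 0F refl) (edge 1F 2F refl) (edge 1F 3F refl) k)
                (cong (λ vu → occurrences k (vu ∷ c v x ∷ c v y ∷ []))
                      (colour-sym G li (edge 1F 0F refl)))
        at-x : ∀ k → colDeg G c k x ≡ occurrences k (c u x ∷ c v x ∷ c x z ∷ [])
        at-x k =
          trans (colDeg-at c (distinct 0F 1F λ ()) uz vz (edge 2F 0F refl) (edge 2F 1F refl) xz k)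
                (cong₂ (λ xu xv → occurrences k (xu ∷ xv ∷ c x z ∷ []))
                       (colour-sym G li (edge 2F 0F refl)) (colour-sym G li (edge 2F 1F refl)))
        at-y : ∀ k → colDeg G c k y ≡ occurrences k (c u y ∷ c v y ∷ c y w ∷ [])
        at-y k =
          trans (colDeg-at c (distinct 0F 1F λ ()) uw vw (edge 3F 0F refl) (edge 3F 1F refl) yw k)
                (cong₂ (λ yu yv → occurrences k (yu ∷ yv ∷ c y w ∷ []))
                       (colour-sym G li (edge 3F 0F refl)) (colour-sym G li (edge 3F 1F refl)))
        tip-colours : c u x ≢ c v x
        tip-colours = tip-colours-differ _ _ _ _ _ (c x z) (c y w)
          (edge-irregular G li (edge 0F 1F refl) at-u at-v)
          (edge-irregular G li (edge 0F 2F refl) at-u at-x)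
          (edge-irregular G li (edge 0F 3F refl) at-u at-y)
          (edge-irregular G li (edge 1F 2F refl) at-v at-x)
          (edge-irregular G li (edge 1F 3F refl) at-v at-y)

    pendant-colDeg-at-2F : ∀ {f z} → DiamondIn G f → Adj G (f 2F) z → (∀ i → f i ≢ z) →
                           colDeg G c (c (f 2F) z) (f 2F) ≡ 2
    pendant-colDeg-at-2F d@(_ , edge) xz z∉
      with ∃-neighbour-outside G ((DiamondIn-distinct G d 0F 1F (λ ()) ∷ []) ∷ [] ∷ [])
                                 (edge 3F 0F refl ∷ edge 3F 1F refl ∷ [])
                                 (≤-reflexive (sym (cubic _)))
    ... | w , yw , w≢u ∷ w≢v ∷ [] =
      pendant-colDeg-at-tip d xz (z∉ 0F) (z∉ 1F) yw (≢-sym w≢u) (≢-sym w≢v)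

    pendant-colDeg : ∀ {f z} → DiamondIn G f → (a : Fin 4) → Adj G (f a) z → (∀ i → f i ≢ z) →
                     colDeg G c (c (f a) z) (f a) ≡ 2
    pendant-colDeg d 0F az z∉ = ⊥-elim (diamond-centre-saturated d z∉ az)
    pendant-colDeg d 1F az z∉ =
      ⊥-elim (diamond-centre-saturated (DiamondIn-∘ G (transpose 0F 1F) swap-centres d)
                                       (z∉ ∘ (transpose 0F 1F ⟨$⟩ʳ_)) az)
    pendant-colDeg d 2F az z∉ = pendant-colDeg-at-2F d az z∉
    pendant-colDeg d 3F az z∉ =
      pendant-colDeg-at-2F (DiamondIn-∘ G (transpose 2F 3F) swap-tips d) az
                          (z∉ ∘ (transpose 2F 3F ⟨$⟩ʳ_))

proposition8 : ∀ {n} (G : Graph n) → Cubic G →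
    (f₁ f₂ : Fin 4 → Fin n) → DiamondIn G f₁ → DiamondIn G f₂ →
    (∀ a b → f₁ a ≢ f₂ b) →
    (∃[ a ] ∃[ b ] Adj G (f₁ a) (f₂ b)) →
    ¬ (∃[ c ] LocallyIrregular2Coloring G c)
proposition8 G cubic f₁ f₂ d₁ d₂ disjoint (a , b , ab) (c , li) =
  proj₂ li (f₁ a) (f₂ b) ab (trans at-f₁ (sym at-f₂))
  where
    at-f₁ : colDeg G c (c (f₁ a) (f₂ b)) (f₁ a) ≡ 2
    at-f₁ = pendant-colDeg G cubic li d₁ a ab (λ i → disjoint i b)
    at-f₂ : colDeg G c (c (f₁ a) (f₂ b)) (f₂ b) ≡ 2
    at-f₂ = subst (λ k → colDeg G c k (f₂ b) ≡ 2) (colour-sym G li (Adj-sym G ab))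
                  (pendant-colDeg G cubic li d₂ b (Adj-sym G ab) (λ i → ≢-sym (disjoint a i)))
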